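{- For all positive integers $n$ and $k$, the multigraph $K_n^k$ is not DP-degree-colorable.
   Context: For a multigraph $G$ and distinct $u,v\in V(G)$, $e_G(u,v)$ is the number of edges joining $u$ and $v$, and $\deg_G(v)=\sum_{u\neq v}e_G(v,u)$. A cover of $G$ is a pair $(L,H)$ where $L$ assigns pairwise disjoint sets $L(v)$ to the vertices of $G$ and $H$ is a simple graph with vertex set $\bigcup_{v}L(v)$ such that each $H[L(v)]$ is complete and for distinct $u,v$ the edges of $H$ between $L(u)$ and $L(v)$ form the union of $e_G(u,v)$ (possibly empty) matchings. An $(L,H)$-coloring of $G$ is an independent set of $H$ of size $|V(G)|$. $G$ is DP-degree-colorable if it has an $(L,H)$-coloring for every cover $(L,H)$ with $|L(v)|\ge\deg_G(v)$ for all $v$. $K_n^k$ is the multigraph obtained from the complete graph $K_n$ by replacing each edge by $k$ parallel edges. -}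

module Defs where

open import Level using (0ℓ)
open import Data.Nat using (ℕ; zero; suc; _+_; _≤_)
open import Data.Fin using (Fin; _≟_)
open import Data.List using (List; map)
open import Data.Nat.ListAction using (sum)
open import Data.List.Base using (allFin)
open import Data.Product using (Σ; ∃; _×_; _,_; proj₁; proj₂)
open import Relation.Nullary using (¬_; Dec; yes; no)
open import Relation.Binary.PropositionalEquality using (_≡_)

-- A (loopless) multigraph on vertex set Fin n: e u v = number of edges
-- joining u and v (only meaningful for u ≠ v), symmetric.
record Multigraph (n : ℕ) : Set where
  field
    e     : Fin n → Fin n → ℕ
    e-sym : ∀ u v → e u v ≡ e v u
open Multigraph public

deg : ∀ {n} → Multigraph n → Fin n → ℕ
deg {n} G v = sum (map term (allFin n))
  where
    term : Fin n → ℕ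
    term u with u ≟ v
    ... | yes _ = 0
    ... | no  _ = e G v u

K : (n k : ℕ) → Multigraph n
K n k = record { e = f ; e-sym = sym' }
  where
    f : Fin n → Fin n → ℕ
    f u v with u ≟ v
    ... | yes _ = 0
    ... | no  _ = k
    open import Relation.Binary.PropositionalEquality using (refl; sym)
    sym' : ∀ u v → f u v ≡ f v u
    sym' u v with u ≟ v | v ≟ u
    ... | yes _ | yes _ = refl
    ... | no  _ | no  _ = refl
    ... | yes p | no q = Data.Empty.⊥-elim (q (sym p)) where import Data.Empty
    ... | no q | yes p = Data.Empty.⊥-elim (q (sym p)) where import Data.Empty

IsMatching : {A B : Set} → (A → B → Set) → Set
IsMatching {A} {B} M =
  (∀ {a b b'} → M a b → M a b' → b ≡ b') ×
  (∀ {a a' b} → M a b → M a' b → a ≡ a')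

-- A cover (L, H) of G.  L(v) is represented by Fin (size v); the vertex
-- set of H is the disjoint union Σ v, Fin (size v), so the L(v) are
-- pairwise disjoint by construction.
record Cover {n : ℕ} (G : Multigraph n) : Set₁ where
  field
    size : Fin n → ℕ
  V : Set
  V = Σ (Fin n) (λ v → Fin (size v))
  field
    adj       : V → V → Set
    adj-sym   : ∀ x y → adj x y → adj y x
    adj-irr   : ∀ x → ¬ adj x x
    complete  : ∀ v (i j : Fin (size v)) → ¬ i ≡ j → adj (v , i) (v , j)
    matchings : ∀ u v → ¬ u ≡ v →
      Σ (Fin (e G u v) → Fin (size u) → Fin (size v) → Set) λ M →
        (∀ t → IsMatching (M t)) ×
        (∀ i j → (adj (u , i) (v , j) → ∃ λ t → M t i j) ×
                 ((∃ λ t → M t i j) → adj (u , i) (v , j)))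
open Cover public

-- An (L,H)-coloring: an independent set of H of size |V(G)| = n,
-- given as an injective map Fin n → V(H) with pairwise non-adjacent images.
Coloring : ∀ {n} {G : Multigraph n} → Cover G → Set
Coloring {n} C =
  Σ (Fin n → V C) λ I →
    (∀ a b → I a ≡ I b → a ≡ b) ×
    (∀ a b → ¬ adj C (I a) (I b))

DPDegreeColorable : ∀ {n} → Multigraph n → Set₁
DPDegreeColorable {n} G =
  (C : Cover G) → (∀ v → deg G v ≤ size C v) → Coloring C

-- Let n = m + 1 and give every vertex of K_n^k the palette Fin (m k), split
-- into m blocks of k colors.  Between two distinct vertices, join two colors
-- exactly when they lie in blocks with the same index: this is a disjoint union
-- of copies of K_{k,k}, and K_{k,k} is the union of the k perfect matchings
-- {a + b ≡ t (mod k)}.  The palettes have size m k = deg, but an independent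
-- set of size n must use colors from pairwise distinct blocks at its n
-- vertices, which the pigeonhole principle forbids.
module Submission where

open import Defs
open import Data.Nat using (ℕ; suc; _+_; _*_; _∸_; _≤_; _<_; _≥_; z≤n; NonZero)
open import Data.Nat.Properties using (≤-refl; +-mono-≤; +-monoʳ-≤; +-cancelˡ-≤; +-comm; +-assoc; m+[n∸m]≡n; <⇒≤; +-commutativeSemigroup; module ≤-Reasoning)
open import Data.Nat.DivMod using (_%_; %-distribˡ-+; m%n%n≡m%n; m<n⇒m%n≡m; [m+n]%n≡m%n; m%n<n)
open import Data.Nat.ListAction using (sum)
open import Data.Fin using (Fin; _≟_; toℕ; fromℕ<; quotient; remainder; remQuot; combine)
open import Data.Fin.Properties using (toℕ-injective; toℕ<n; toℕ-fromℕ<; combine-remQuot; pigeonhole; <⇒≢)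
open import Data.List using ([]; _∷_; map; length; allFin)
open import Data.List.Properties using (length-tabulate)
open import Data.List.Membership.Propositional using (_∈_)
open import Data.List.Membership.Propositional.Properties using (∈-allFin)
open import Data.List.Relation.Unary.Any using (here; there)
open import Data.Product using (Σ; ∃; _×_; _,_; proj₁; proj₂; uncurry)
open import Data.Sum using (_⊎_; inj₁; inj₂)
open import Data.Empty using (⊥-elim)
open import Relation.Nullary using (¬_; yes; no)
open import Relation.Binary.PropositionalEquality
open import Function using (_∘_)
open import Algebra.Properties.CommutativeSemigroup +-commutativeSemigroup using (x∙yz≈y∙xz)

sum-map-≤ : ∀ {A : Set} {f : A → ℕ} {k} → (∀ x → f x ≤ k) →
            ∀ xs → sum (map f xs) ≤ length xs * k
sum-map-≤ f≤k []       = z≤n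
sum-map-≤ f≤k (x ∷ xs) = +-mono-≤ (f≤k x) (sum-map-≤ f≤k xs)

sum-map-vanishing-≤ : ∀ {A : Set} {f : A → ℕ} {k v} → (∀ x → f x ≤ k) → f v ≡ 0 →
                      ∀ {xs} → v ∈ xs → k + sum (map f xs) ≤ length xs * k
sum-map-vanishing-≤ {k = k} f≤k fv≡0 {x ∷ xs} (here refl) rewrite fv≡0 =
  +-monoʳ-≤ k (sum-map-≤ f≤k xs)
sum-map-vanishing-≤ {f = f} {k} f≤k fv≡0 {x ∷ xs} (there v∈xs) = begin
  k + (f x + sum (map f xs)) ≡⟨ x∙yz≈y∙xz k (f x) _ ⟩
  f x + (k + sum (map f xs)) ≤⟨ +-mono-≤ (f≤k x) (sum-map-vanishing-≤ f≤k fv≡0 v∈xs) ⟩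
  k + length xs * k          ∎
  where open ≤-Reasoning

deg-K≤ : ∀ m k v → deg (K (suc m) k) v ≤ m * k
deg-K≤ m k v = +-cancelˡ-≤ k _ _
  (subst (λ l → k + deg (K (suc m) k) v ≤ l * k) (length-tabulate {n = suc m} (λ u → u))
    (sum-map-vanishing-≤ {f = summand} summand≤k summand-v≡0 (∈-allFin v)))
  where
    -- The summand of deg is a with-function local to Defs; it cannot be named,
    -- so it is pinned down by unification against the definition of deg.
    summand : Fin (suc m) → ℕ
    summand = _
    deg-unfold : deg (K (suc m) k) v ≡ sum (map summand (allFin (suc m)))
    deg-unfold = refl
    summand≤k : ∀ u → summand u ≤ k
    summand≤k u with u ≟ v
    ... | yes _ = z≤n
    ... | no _ with v ≟ u
    ...   | yes _ = z≤n
    ...   | no _  = ≤-refl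
    summand-v≡0 : summand v ≡ 0
    summand-v≡0 with v ≟ v
    ... | yes _ = refl
    ... | no v≢v = ⊥-elim (v≢v refl)

[m%n+o]%n≡[m+o]%n : ∀ m o n .{{_ : NonZero n}} → (m % n + o) % n ≡ (m + o) % n
[m%n+o]%n≡[m+o]%n m o n = begin
  (m % n + o) % n         ≡⟨ %-distribˡ-+ (m % n) o n ⟩
  (m % n % n + o % n) % n ≡⟨ cong (λ r → (r + o % n) % n) (m%n%n≡m%n m n) ⟩
  (m % n + o % n) % n     ≡⟨ %-distribˡ-+ m o n ⟨
  (m + o) % n             ∎
  where open ≡-Reasoning

+-%-cancelˡ : ∀ {a b c n} .{{_ : NonZero n}} → a ≤ n → b < n → c < n →
              (a + b) % n ≡ (a + c) % n → b ≡ c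
+-%-cancelˡ {a} {b} {c} {n} a≤n b<n c<n eq = begin
  b                                 ≡⟨ recover b<n ⟩
  ((a + b) % n + (n ∸ a)) % n       ≡⟨ cong (λ r → (r + (n ∸ a)) % n) eq ⟩
  ((a + c) % n + (n ∸ a)) % n       ≡⟨ recover c<n ⟨
  c                                 ∎
  where
    open ≡-Reasoning
    recover : ∀ {x} → x < n → x ≡ ((a + x) % n + (n ∸ a)) % n
    recover {x} x<n = begin
      x                           ≡⟨ m<n⇒m%n≡m x<n ⟨
      x % n                       ≡⟨ [m+n]%n≡m%n x n ⟨
      (x + n) % n                 ≡⟨ cong (λ r → (x + r) % n) (m+[n∸m]≡n a≤n) ⟨
      (x + (a + (n ∸ a))) % n     ≡⟨ cong (_% n) (x∙yz≈y∙xz x a (n ∸ a)) ⟩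
      (a + (x + (n ∸ a))) % n     ≡⟨ cong (_% n) (+-assoc a x (n ∸ a)) ⟨
      (a + x + (n ∸ a)) % n       ≡⟨ [m%n+o]%n≡[m+o]%n (a + x) (n ∸ a) n ⟨
      ((a + x) % n + (n ∸ a)) % n ∎

-- The addition table of ℤ/k is a Latin square, so its k level sets are perfect
-- matchings that together cover Fin k × Fin k.
module _ (k : ℕ) .{{_ : NonZero k}} where

  SumsTo : Fin k → Fin k → Fin k → Set
  SumsTo t a b = (toℕ a + toℕ b) % k ≡ toℕ t

  SumsTo-comm : ∀ {t} a b → SumsTo t a b → SumsTo t b a
  SumsTo-comm a b ab = trans (cong (_% k) (+-comm (toℕ b) (toℕ a))) ab

  SumsTo-isMatching : ∀ t → IsMatching (SumsTo t)
  SumsTo-isMatching t =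
    same-first , λ {a} {a'} {b} ab a'b → same-first (SumsTo-comm a b ab) (SumsTo-comm a' b a'b)
    where
      same-first : ∀ {a b b'} → SumsTo t a b → SumsTo t a b' → b ≡ b'
      same-first {a} {b} {b'} ab ab' =
        toℕ-injective (+-%-cancelˡ (<⇒≤ (toℕ<n a)) (toℕ<n b) (toℕ<n b') (trans ab (sym ab')))

  SumsTo-total : ∀ a b → ∃ λ t → SumsTo t a b
  SumsTo-total a b = fromℕ< (m%n<n (toℕ a + toℕ b) k) , sym (toℕ-fromℕ< _)

module BlockCover (n b k : ℕ) .{{_ : NonZero k}} where

  block : Fin (b * k) → Fin b
  block = quotient k

  offset : Fin (b * k) → Fin k
  offset = remainder {b} k

  block-offset-injective : ∀ {i j} → block i ≡ block j → offset i ≡ offset j → i ≡ j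
  block-offset-injective {i} {j} same-block same-offset = begin
    i                                 ≡⟨ combine-remQuot {b} k i ⟨
    uncurry combine (remQuot {b} k i) ≡⟨ cong₂ combine same-block same-offset ⟩
    uncurry combine (remQuot {b} k j) ≡⟨ combine-remQuot {b} k j ⟩
    j                                 ∎
    where open ≡-Reasoning

  Color : Set
  Color = Σ (Fin n) λ _ → Fin (b * k)

  Conflict : Color → Color → Set
  Conflict (u , i) (v , j) = (u ≡ v × i ≢ j) ⊎ (u ≢ v × block i ≡ block j)

  Conflict-sym : ∀ x y → Conflict x y → Conflict y x
  Conflict-sym _ _ (inj₁ (u≡v , i≢j)) = inj₁ (sym u≡v , i≢j ∘ sym)
  Conflict-sym _ _ (inj₂ (u≢v , same-block)) = inj₂ (u≢v ∘ sym , sym same-block)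

  Conflict-irrefl : ∀ x → ¬ Conflict x x
  Conflict-irrefl _ (inj₁ (_ , i≢i)) = i≢i refl
  Conflict-irrefl _ (inj₂ (u≢u , _)) = u≢u refl

  BlockMatching : Fin k → Fin (b * k) → Fin (b * k) → Set
  BlockMatching t i j = block i ≡ block j × SumsTo k t (offset i) (offset j)

  BlockMatching-isMatching : ∀ t → IsMatching (BlockMatching t)
  BlockMatching-isMatching t =
      (λ (bij , ij) (bij' , ij') →
         block-offset-injective (trans (sym bij) bij') (proj₁ (SumsTo-isMatching k t) ij ij'))
    , (λ (bij , ij) (bi'j , i'j) →
         block-offset-injective (trans bij (sym bi'j)) (proj₂ (SumsTo-isMatching k t) ij i'j))

  blockMatchings : ∀ u v → u ≢ v →
    Σ (Fin (e (K n k) u v) → Fin (b * k) → Fin (b * k) → Set) λ M →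
      (∀ t → IsMatching (M t)) ×
      (∀ i j → (Conflict (u , i) (v , j) → ∃ λ t → M t i j) ×
               ((∃ λ t → M t i j) → Conflict (u , i) (v , j)))
  blockMatchings u v u≢v with u ≟ v
  ... | yes u≡v = ⊥-elim (u≢v u≡v)
  ... | no _    = BlockMatching , BlockMatching-isMatching , λ i j →
      (λ { (inj₁ (u≡v , _)) → ⊥-elim (u≢v u≡v)
         ; (inj₂ (_ , same-block)) →
             let t , ij = SumsTo-total k (offset i) (offset j) in t , same-block , ij })
    , (λ (_ , same-block , _) → inj₂ (u≢v , same-block))

  blockCover : Cover (K n k)
  blockCover = record
    { size      = λ _ → b * k
    ; adj       = Conflict
    ; adj-sym   = Conflict-sym
    ; adj-irr   = Conflict-irrefl
    ; complete  = λ _ _ _ i≢j → inj₁ (refl , i≢j)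
    ; matchings = blockMatchings
    }

  nonconflicting-sameBlock⇒≡ : ∀ x y → block (proj₂ x) ≡ block (proj₂ y) → ¬ Conflict x y → x ≡ y
  nonconflicting-sameBlock⇒≡ (u , i) (v , j) same-block ¬conflict with u ≟ v | i ≟ j
  ... | no u≢v   | _        = ⊥-elim (¬conflict (inj₂ (u≢v , same-block)))
  ... | yes refl | no i≢j   = ⊥-elim (¬conflict (inj₁ (refl , i≢j)))
  ... | yes refl | yes refl = refl

  blockCover-uncolorable : b < n → ¬ Coloring blockCover
  blockCover-uncolorable b<n (I , I-injective , independent)
    with x , y , x<y , same-block ← pigeonhole b<n (block ∘ proj₂ ∘ I)
    = <⇒≢ x<y (I-injective x y (nonconflicting-sameBlock⇒≡ (I x) (I y) same-block (independent x y)))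

lemma1 : ∀ (n k : ℕ) → n ≥ 1 → k ≥ 1 → ¬ DPDegreeColorable (K n k)
lemma1 (suc m) k@(suc _) _ _ colorable =
  blockCover-uncolorable ≤-refl (colorable blockCover (deg-K≤ m k))
  where open BlockCover (suc m) m k
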